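{- Let $\mathcal{G}$ be a set of positions closed under options and let $A\in\{\mathbb{Z},\mathbb{D}\}$. If every $G\in\mathcal{G}$ has the $\Diamond_A$-property, then every $G\in\mathcal{G}$ satisfies $G\in A$.
   Context: Positions are short (finite, loop-free) combinatorial games $G=\{G^{\mathcal L}\mid G^{\mathcal R}\}$ with finite sets of Left/Right options; $G^L$, $G^R$ denote individual options. A set of positions is closed under options if every option of a member is a member. The relations $=,\le,<$ are the usual ones; $G\ngeq H$ means "$G<H$ or $G$ is fuzzy with $H$". $\mathbb{Z}$ and $\mathbb{D}$ (dyadic rationals) are viewed as games; "$G\in A$" means $G$ equals some element of $A$. The $A$-stops: $\mathrm{LS}_A(G)=\mathrm{RS}_A(G)=$ the element of $A$ equal to $G$ if $G\in A$; otherwise $\mathrm{LS}_A(G)=\max_{G^L}\mathrm{RS}_A(G^L)$, $\mathrm{RS}_A(G)=\min_{G^R}\mathrm{LS}_A(G^R)$. Guide options: $\mathrm{gd}^L_A(G)=\emptyset$ if $G\in A$; if $G\notin A$ and some Left option equals $\mathrm{LS}_A(G)$, then $\mathrm{gd}^L_A(G)=\{G^L:G^L=\mathrm{LS}_A(G)\}$; otherwise $\mathrm{gd}^L_A(G)=\{G^L:\mathrm{RS}_A(G^L)=\mathrm{LS}_A(G)\}$; dually $\mathrm{gd}^R_A(G)=\emptyset$ if $G\in A$; if $G\notin A$ and some Right option equals $\mathrm{RS}_A(G)$ then $\mathrm{gd}^R_A(G)=\{G^R:G^R=\mathrm{RS}_A(G)\}$; otherwise $\mathrm{gd}^R_A(G)=\{G^R:\mathrm{LS}_A(G^R)=\mathrm{RS}_A(G)\}$.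 $G$ has the $\Diamond_A$-property if $G\in A$, or there exist $G^L\in\mathrm{gd}^L_A(G)$, $G^R\in\mathrm{gd}^R_A(G)$, $x\in A$ with $G^L\ngeq x$ and $x\ngeq G^R$. -}

module Defs where

open import Data.Bool using (Bool; true; false; not; _∧_; _∨_; T)
open import Data.List using (List; []; _∷_; _++_)
open import Data.List.Membership.Propositional using (_∈_)
open import Data.Nat using (ℕ; zero; suc)
open import Data.Integer using (ℤ; +_; -[1+_])
open import Data.Product using (Σ; ∃; _×_; _,_)
open import Data.Sum using (_⊎_)
open import Relation.Nullary using (¬_)
open import Data.Empty using (⊥)
open import Data.Unit using (⊤)

data Game : Set where
  ⟨_∣_⟩ : List Game → List Game → Game

leftOpts : Game → List Game
leftOpts ⟨ L ∣ R ⟩ = L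

rightOpts : Game → List Game
rightOpts ⟨ L ∣ R ⟩ = R

-- Conway's order:  G ≤ H  iff  there is no G^L with H ≤ G^L
--                         and there is no H^R with H^R ≤ G.
-- Computed as a boolean (short games have decidable order).

mutual
  leB : Game → Game → Bool
  leB G@(⟨ GL ∣ GR ⟩) H@(⟨ HL ∣ HR ⟩) = not (someGe GL H) ∧ not (someLe HR G)

  someGe : List Game → Game → Bool
  someGe [] H = false
  someGe (x ∷ xs) H = leB H x ∨ someGe xs H

  someLe : List Game → Game → Bool
  someLe [] G = false
  someLe (y ∷ ys) G = leB y G ∨ someLe ys G

infix 4 _≤g_ _≈g_ _≱g_

_≤g_ : Game → Game → Set
G ≤g H = T (leB G H)

_≈g_ : Game → Game → Set
G ≈g H = (G ≤g H) × (H ≤g G)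

_≱g_ : Game → Game → Set
G ≱g H = ¬ (H ≤g G)

mutual
  neg : Game → Game
  neg ⟨ L ∣ R ⟩ = ⟨ negs R ∣ negs L ⟩

  negs : List Game → List Game
  negs [] = []
  negs (x ∷ xs) = neg x ∷ negs xs

mutual
  _⊕_ : Game → Game → Game
  G@(⟨ GL ∣ GR ⟩) ⊕ H@(⟨ HL ∣ HR ⟩) =
    ⟨ addL GL H ++ addR G HL ∣ addL GR H ++ addR G HR ⟩

  addL : List Game → Game → List Game
  addL [] H = []
  addL (x ∷ xs) H = (x ⊕ H) ∷ addL xs H

  addR : Game → List Game → List Game
  addR G [] = []
  addR G (y ∷ ys) = (G ⊕ y) ∷ addR G ys

zeroG : Game
zeroG = ⟨ [] ∣ [] ⟩

natG : ℕ → Game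
natG zero = zeroG
natG (suc n) = ⟨ natG n ∷ [] ∣ [] ⟩

intG : ℤ → Game
intG (+ n) = natG n
intG -[1+ n ] = neg (natG (suc n))

halfG : ℕ → Game
halfG zero = ⟨ zeroG ∷ [] ∣ [] ⟩
halfG (suc k) = ⟨ zeroG ∷ [] ∣ halfG k ∷ [] ⟩

mulℕ : ℕ → Game → Game
mulℕ zero G = zeroG
mulℕ (suc n) G = G ⊕ mulℕ n G

mulℤ : ℤ → Game → Game
mulℤ (+ n) G = mulℕ n G
mulℤ -[1+ n ] G = neg (mulℕ (suc n) G)

dyG : ℤ × ℕ → Game
dyG (m , k) = mulℤ m (halfG k)

data Arena : Set where
  ZZ DD : Arena

-- elements of A (𝔻 represented as pairs (m , k) meaning m/2^k)
Val : Arena → Set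
Val ZZ = ℤ
Val DD = ℤ × ℕ

num : (A : Arena) → Val A → Game
num ZZ m = intG m
num DD x = dyG x

InA : Arena → Game → Set
InA A G = ∃ λ (x : Val A) → G ≈g num A x

-- A-stops, as (functional up to equality) relations, by recursion on G.
-- IsLS A G x : LS_A(G) = x ;  IsRS A G x : RS_A(G) = x.
-- (LS_A(G) = max over Left options of RS_A(G^L): attained by some option
--  and an upper bound of all of them.)
-- The values are compared via the order of the corresponding number games.

mutual
  IsLS : (A : Arena) → Game → Val A → Set
  IsLS A G@(⟨ L ∣ R ⟩) x =
    (G ≈g num A x) ⊎ (¬ InA A G × SomeRS A L x × AllRSBelow A L x)

  IsRS : (A : Arena) → Game → Val A → Set
  IsRS A G@(⟨ L ∣ R ⟩) x =
    (G ≈g num A x) ⊎ (¬ InA A G × SomeLS A R x × AllLSAbove A R x)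

  SomeRS : (A : Arena) → List Game → Val A → Set
  SomeRS A [] x = ⊥
  SomeRS A (g ∷ gs) x = IsRS A g x ⊎ SomeRS A gs x

  AllRSBelow : (A : Arena) → List Game → Val A → Set
  AllRSBelow A [] x = ⊤
  AllRSBelow A (g ∷ gs) x = (∀ y → IsRS A g y → num A y ≤g num A x) × AllRSBelow A gs x

  SomeLS : (A : Arena) → List Game → Val A → Set
  SomeLS A [] x = ⊥
  SomeLS A (g ∷ gs) x = IsLS A g x ⊎ SomeLS A gs x

  AllLSAbove : (A : Arena) → List Game → Val A → Set
  AllLSAbove A [] x = ⊤
  AllLSAbove A (g ∷ gs) x = (∀ y → IsLS A g y → num A x ≤g num A y) × AllLSAbove A gs x

GdL : (A : Arena) → Game → Game → Set
GdL A G GL =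
  ¬ InA A G × GL ∈ leftOpts G ×
  (∃ λ (s : Val A) → IsLS A G s ×
     (((∃ λ GL' → GL' ∈ leftOpts G × GL' ≈g num A s) × GL ≈g num A s)
      ⊎ (¬ (∃ λ GL' → GL' ∈ leftOpts G × GL' ≈g num A s) × IsRS A GL s)))

GdR : (A : Arena) → Game → Game → Set
GdR A G GR =
  ¬ InA A G × GR ∈ rightOpts G ×
  (∃ λ (s : Val A) → IsRS A G s ×
     (((∃ λ GR' → GR' ∈ rightOpts G × GR' ≈g num A s) × GR ≈g num A s)
      ⊎ (¬ (∃ λ GR' → GR' ∈ rightOpts G × GR' ≈g num A s) × IsLS A GR s)))

Diamond : Arena → Game → Set
Diamond A G =
  InA A G ⊎
  (∃ λ GL → ∃ λ GR → ∃ λ (x : Val A) →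
     GdL A G GL × GdR A G GR × (GL ≱g num A x) × (num A x ≱g GR))

ClosedUnderOptions : (Game → Set) → Set
ClosedUnderOptions 𝒢 =
  ∀ G → 𝒢 G →
    (∀ GL → GL ∈ leftOpts G → 𝒢 GL) × (∀ GR → GR ∈ rightOpts G → 𝒢 GR)

-- By induction on G, all options of G lie in A.  If G ∉ A, the Left guide option then
-- equals LS_A(G), the largest value of a Left option, so it dominates every Left option;
-- dually every Right option dominates the Right guide option.  Hence the witness x of the
-- ◇_A-property satisfies G^L ≱ x and x ≱ G^R for all options G^L, G^R, and the simplicity
-- theorem, applied to forms of the elements of A that are closed under options and satisfy
-- G^L ≤ G ≤ G^R, makes G equal to one of these forms.  For ℤ the forms intG z will do; for
-- 𝔻 the finite sums of atoms 0 and ±1/2^j, which are ordered by their values.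

module Submission where

open import Defs
open import Data.Bool using (true; false; not; T)
open import Data.Bool.Properties using (T-∧; T-∨)
open import Data.Empty using (⊥-elim)
open import Data.List using (List; []; _∷_; _++_; map; replicate)
open import Data.List.Membership.Propositional using (_∈_; find; lose)
open import Data.List.Membership.Propositional.Properties using (∈-map⁺; ∈-map⁻; ∈-++⁺ˡ; ∈-++⁺ʳ; ∈-++⁻)
open import Data.List.Extrema.Nat using (argmax; argmax-sel; argmax-all; f[xs]≤f[argmax])
open import Data.List.Relation.Unary.Any using (Any; here; there; any?)
open import Data.List.Relation.Unary.All using (All; []; _∷_; lookup; tabulate; all?)
open import Data.List.Relation.Unary.All.Properties using (¬Any⇒All¬; All¬⇒¬Any; ++⁺; ++⁻; replicate⁺)
open import Data.Nat as ℕ using (ℕ; zero; suc; _≤_; _<_; _∸_; _^_; s≤s; z≤n)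
open import Data.Integer as ℤ using (ℤ; +_; -[1+_]; -_; 0ℤ; 1ℤ; _+_; _-_; _*_)
import Data.Integer.Properties as ℤP
open import Data.Integer.Tactic.RingSolver using (solve-∀)
open import Algebra.Properties.CommutativeSemigroup ℤP.+-commutativeSemigroup using (xy∙z≈xz∙y)
import Data.Nat.Properties as ℕP
open import Data.Product using (∃; _×_; _,_; proj₁; proj₂)
open import Data.Sum as Sum using (_⊎_; inj₁; inj₂)
open import Data.Unit using (tt)
open import Function using (_∘_; _⇔_; mk⇔; Equivalence)
open Equivalence using (to; from)
open import Relation.Binary using (Preorder; Decidable)
import Relation.Binary.Reasoning.Preorder as PreorderReasoning
open import Relation.Nullary using (¬_; Dec; yes; no; T?; ¬?; _×-dec_)
open import Relation.Binary.PropositionalEquality using (_≡_; refl; sym; trans; cong; cong₂; subst; subst₂; module ≡-Reasoning)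

module _ (P : Game → Set) (step : ∀ {L R} → All P L → All P R → P ⟨ L ∣ R ⟩) where
  mutual
    game-ind : ∀ G → P G
    game-ind ⟨ L ∣ R ⟩ = step (game-ind* L) (game-ind* R)

    game-ind* : ∀ Gs → All P Gs
    game-ind* [] = []
    game-ind* (G ∷ Gs) = game-ind G ∷ game-ind* Gs

T-not : ∀ {b} → T (not b) ⇔ (¬ T b)
T-not {true} = mk⇔ (λ ()) (λ ¬t → ¬t tt)
T-not {false} = mk⇔ (λ _ ()) (λ _ → tt)

someGe⇔Any : ∀ xs {H} → T (someGe xs H) ⇔ Any (H ≤g_) xs
someGe⇔Any [] = mk⇔ (λ ()) (λ ())
someGe⇔Any (x ∷ xs) = mk⇔
  (Sum.[ here , there ∘ to (someGe⇔Any xs) ]′ ∘ to T-∨)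
  (λ { (here le) → from T-∨ (inj₁ le)
     ; (there a) → from T-∨ (inj₂ (from (someGe⇔Any xs) a)) })

someLe⇔Any : ∀ ys {G} → T (someLe ys G) ⇔ Any (_≤g G) ys
someLe⇔Any [] = mk⇔ (λ ()) (λ ())
someLe⇔Any (y ∷ ys) = mk⇔
  (Sum.[ here , there ∘ to (someLe⇔Any ys) ]′ ∘ to T-∨)
  (λ { (here le) → from T-∨ (inj₁ le)
     ; (there a) → from T-∨ (inj₂ (from (someLe⇔Any ys) a)) })

≤g⇔ : ∀ {G H} → G ≤g H ⇔ (All (_≱g H) (leftOpts G) × All (G ≱g_) (rightOpts H))
≤g⇔ {⟨ GL ∣ GR ⟩} {⟨ HL ∣ HR ⟩} = mk⇔
  (λ le → let a , b = to T-∧ le in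
     ¬Any⇒All¬ GL (to T-not a ∘ from (someGe⇔Any GL)) ,
     ¬Any⇒All¬ HR (to T-not b ∘ from (someLe⇔Any HR)))
  (λ (p , q) → from T-∧
     ( from T-not (All¬⇒¬Any p ∘ to (someGe⇔Any GL))
     , from T-not (All¬⇒¬Any q ∘ to (someLe⇔Any HR))))

≤g-intro : ∀ G H → All (_≱g H) (leftOpts G) → All (G ≱g_) (rightOpts H) → G ≤g H
≤g-intro G H p q = from (≤g⇔ {G} {H}) (p , q)

≤g-leftOpt : ∀ G H {x} → G ≤g H → x ∈ leftOpts G → x ≱g H
≤g-leftOpt G H le = lookup (proj₁ (to (≤g⇔ {G} {H}) le))

≤g-rightOpt : ∀ G H {y} → G ≤g H → y ∈ rightOpts H → G ≱g y
≤g-rightOpt G H le = lookup (proj₂ (to (≤g⇔ {G} {H}) le))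

≤g-refl : ∀ G → G ≤g G
≤g-refl = game-ind (λ G → G ≤g G) λ {L} {R} reflL reflR → let G = ⟨ L ∣ R ⟩ in
  ≤g-intro G G (tabulate λ {x} x∈L G≤x → ≤g-leftOpt G x G≤x x∈L (lookup reflL x∈L))
               (tabulate λ {y} y∈R y≤G → ≤g-rightOpt y G y≤G y∈R (lookup reflR y∈R))

leftOpt-≱ : ∀ G {x} → x ∈ leftOpts G → x ≱g G
leftOpt-≱ G = ≤g-leftOpt G G (≤g-refl G)

rightOpt-≱ : ∀ G {y} → y ∈ rightOpts G → G ≱g y
rightOpt-≱ G = ≤g-rightOpt G G (≤g-refl G)

mutual
  size : Game → ℕ
  size ⟨ L ∣ R ⟩ = suc (sizes L ℕ.+ sizes R)

  sizes : List Game → ℕ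
  sizes [] = 0
  sizes (G ∷ Gs) = size G ℕ.+ sizes Gs

size-∈ : ∀ {x xs} → x ∈ xs → size x ≤ sizes xs
size-∈ {xs = y ∷ ys} (here refl) = ℕP.m≤m+n (size y) (sizes ys)
size-∈ {xs = y ∷ ys} (there x∈) = ℕP.m≤n⇒m≤o+n (size y) (size-∈ x∈)

size-leftOpt : ∀ G {x} → x ∈ leftOpts G → size x < size G
size-leftOpt ⟨ L ∣ R ⟩ x∈ = s≤s (ℕP.m≤n⇒m≤n+o (sizes R) (size-∈ x∈))

size-rightOpt : ∀ G {x} → x ∈ rightOpts G → size x < size G
size-rightOpt ⟨ L ∣ R ⟩ x∈ = s≤s (ℕP.m≤n⇒m≤o+n (sizes L) (size-∈ x∈))

shrink-first : ∀ {x x' y n} → x' < x → x ℕ.+ y < suc n → y ℕ.+ x' < n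
shrink-first {x} {x'} {y} {n} x'<x sz =
  ℕP.<-≤-trans (ℕP.+-monoʳ-< y x'<x) (subst (_≤ n) (ℕP.+-comm x y) (ℕP.≤-pred sz))

shrink-second : ∀ {x y y' n} → y' < y → x ℕ.+ y < suc n → y' ℕ.+ x < n
shrink-second {x} {y} {y'} {n} y'<y sz =
  ℕP.<-≤-trans (ℕP.+-monoˡ-< x y'<y) (subst (_≤ n) (ℕP.+-comm x y) (ℕP.≤-pred sz))

≤g-trans-bounded : ∀ n G H K → size G ℕ.+ size H ℕ.+ size K < n → G ≤g H → H ≤g K → G ≤g K
≤g-trans-bounded (suc n) G H K sz G≤H H≤K = ≤g-intro G K (tabulate left) (tabulate right)
  where
  left : ∀ {x} → x ∈ leftOpts G → x ≱g K
  left {x} x∈ K≤x = ≤g-leftOpt G H G≤H x∈ (≤g-trans-bounded n H K x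
    (shrink-first (size-leftOpt G x∈) (subst (_< suc n) (ℕP.+-assoc (size G) (size H) (size K)) sz))
    H≤K K≤x)
  right : ∀ {y} → y ∈ rightOpts K → G ≱g y
  right {y} y∈ y≤G = ≤g-rightOpt H K H≤K y∈ (≤g-trans-bounded n y G H
    (subst (_< n) (sym (ℕP.+-assoc (size y) (size G) (size H))) (shrink-second (size-rightOpt K y∈) sz))
    y≤G G≤H)

≤g-trans : ∀ {G H K} → G ≤g H → H ≤g K → G ≤g K
≤g-trans {G} {H} {K} = ≤g-trans-bounded _ G H K ℕP.≤-refl

≈g-refl : ∀ {G} → G ≈g G
≈g-refl {G} = ≤g-refl G , ≤g-refl G

≈g-sym : ∀ {G H} → G ≈g H → H ≈g G
≈g-sym (G≤H , H≤G) = H≤G , G≤H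

≈g-trans : ∀ {G H K} → G ≈g H → H ≈g K → G ≈g K
≈g-trans {G} {H} {K} (G≤H , H≤G) (H≤K , K≤H) =
  ≤g-trans {G} {H} {K} G≤H H≤K , ≤g-trans {K} {H} {G} K≤H H≤G

≤g-preorder : Preorder _ _ _
≤g-preorder = record
  { Carrier = Game
  ; _≈_ = _≈g_
  ; _≲_ = _≤g_
  ; isPreorder = record
    { isEquivalence = record
      { refl = λ {G} → ≈g-refl {G}
      ; sym = λ {G} {H} → ≈g-sym {G} {H}
      ; trans = λ {G} {H} {K} → ≈g-trans {G} {H} {K}
      }
    ; reflexive = proj₁
    ; trans = λ {G} {H} {K} → ≤g-trans {G} {H} {K}
    }
  }

_≤g?_ : Decidable _≤g_
G ≤g? H = T? (leB G H)

module ≤g-Reasoning = PreorderReasoning ≤g-preorder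

≈⇒IsRS : ∀ {A} G {y} → G ≈g num A y → IsRS A G y
≈⇒IsRS ⟨ _ ∣ _ ⟩ = inj₁

≈⇒IsLS : ∀ {A} G {y} → G ≈g num A y → IsLS A G y
≈⇒IsLS ⟨ _ ∣ _ ⟩ = inj₁

IsRS⇒≈ : ∀ {A} G {s} → InA A G → IsRS A G s → G ≈g num A s
IsRS⇒≈ ⟨ _ ∣ _ ⟩ _ (inj₁ G≈s) = G≈s
IsRS⇒≈ ⟨ _ ∣ _ ⟩ G∈A (inj₂ (G∉A , _)) = ⊥-elim (G∉A G∈A)

IsLS⇒≈ : ∀ {A} G {s} → InA A G → IsLS A G s → G ≈g num A s
IsLS⇒≈ ⟨ _ ∣ _ ⟩ _ (inj₁ G≈s) = G≈s
IsLS⇒≈ ⟨ _ ∣ _ ⟩ G∈A (inj₂ (G∉A , _)) = ⊥-elim (G∉A G∈A)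

AllRSBelow-∈ : ∀ {A L s x y} → AllRSBelow A L s → x ∈ L → IsRS A x y → num A y ≤g num A s
AllRSBelow-∈ (below , _) (here refl) = below _
AllRSBelow-∈ (_ , rest) (there x∈) = AllRSBelow-∈ rest x∈

AllLSAbove-∈ : ∀ {A R s x y} → AllLSAbove A R s → x ∈ R → IsLS A x y → num A s ≤g num A y
AllLSAbove-∈ (above , _) (here refl) = above _
AllLSAbove-∈ (_ , rest) (there x∈) = AllLSAbove-∈ rest x∈

leftOpt≤guideL : ∀ {A} G {GL} → (∀ {x} → x ∈ leftOpts G → InA A x) →
                 GdL A G GL → ∀ {x} → x ∈ leftOpts G → x ≤g GL
leftOpt≤guideL ⟨ L ∣ R ⟩ _ (G∉A , _ , s , inj₁ G≈s , _) _ = ⊥-elim (G∉A (s , G≈s))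
leftOpt≤guideL {A} ⟨ L ∣ R ⟩ {GL} inA (_ , GL∈L , s , inj₂ (_ , _ , below) , guide) {x} x∈L =
  begin
    x        ≈⟨ x≈y ⟩
    num A y  ≲⟨ AllRSBelow-∈ below x∈L (≈⇒IsRS x x≈y) ⟩
    num A s  ≈⟨ GL≈s ⟨
    GL       ∎
  where
  open ≤g-Reasoning
  y = proj₁ (inA x∈L)
  x≈y = proj₂ (inA x∈L)
  GL≈s : GL ≈g num A s
  GL≈s = Sum.[ proj₂ , (λ (_ , GL-rs) → IsRS⇒≈ GL (inA GL∈L) GL-rs) ]′ guide

guideR≤rightOpt : ∀ {A} G {GR} → (∀ {x} → x ∈ rightOpts G → InA A x) →
                  GdR A G GR → ∀ {x} → x ∈ rightOpts G → GR ≤g x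
guideR≤rightOpt ⟨ L ∣ R ⟩ _ (G∉A , _ , t , inj₁ G≈t , _) _ = ⊥-elim (G∉A (t , G≈t))
guideR≤rightOpt {A} ⟨ L ∣ R ⟩ {GR} inA (_ , GR∈R , t , inj₂ (_ , _ , above) , guide) {x} x∈R =
  begin
    GR       ≈⟨ GR≈t ⟩
    num A t  ≲⟨ AllLSAbove-∈ above x∈R (≈⇒IsLS x x≈y) ⟩
    num A y  ≈⟨ x≈y ⟨
    x        ∎
  where
  open ≤g-Reasoning
  y = proj₁ (inA x∈R)
  x≈y = proj₂ (inA x∈R)
  GR≈t : GR ≈g num A t
  GR≈t = Sum.[ proj₂ , (λ (_ , GR-ls) → IsLS⇒≈ GR (inA GR∈R) GR-ls) ]′ guide

-- The simplicity theorem

record IsOrderedFamily (Member : Game → Set) : Set where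
  field
    leftOpt-member  : ∀ G {x} → Member G → x ∈ leftOpts G → Member x
    rightOpt-member : ∀ G {x} → Member G → x ∈ rightOpts G → Member x
    leftOpt≤        : ∀ G {x} → Member G → x ∈ leftOpts G → x ≤g G
    ≤rightOpt       : ∀ G {x} → Member G → x ∈ rightOpts G → G ≤g x

Between : List Game → List Game → Game → Set
Between L R Y = All (_≱g Y) L × All (Y ≱g_) R

between? : ∀ L R Y → Dec (Between L R Y)
between? L R Y = all? (λ l → ¬? (Y ≤g? l)) L ×-dec all? (λ r → ¬? (r ≤g? Y)) R

SimplestBetween : List Game → List Game → Game → Set
SimplestBetween L R Y =
  Between L R Y × ¬ Any (Between L R) (leftOpts Y) × ¬ Any (Between L R) (rightOpts Y)

module _ {Member : Game → Set} (ordered : IsOrderedFamily Member) where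
  open IsOrderedFamily ordered

  simplest-between : ∀ L R X → Member X → Between L R X →
                     ∃ λ Y → Member Y × SimplestBetween L R Y
  simplest-between L R = game-ind P descend
    where
    P : Game → Set
    P X = Member X → Between L R X → ∃ λ Y → Member Y × SimplestBetween L R Y
    descend : ∀ {XL XR} → All P XL → All P XR → P ⟨ XL ∣ XR ⟩
    descend {XL} {XR} ihL ihR X∈ X-btw with any? (between? L R) XL | any? (between? L R) XR
    ... | yes p | _ = let x , x∈ , x-btw = find p in
      lookup ihL x∈ (leftOpt-member ⟨ XL ∣ XR ⟩ X∈ x∈) x-btw
    ... | no _ | yes q = let x , x∈ , x-btw = find q in
      lookup ihR x∈ (rightOpt-member ⟨ XL ∣ XR ⟩ X∈ x∈) x-btw
    ... | no ¬p | no ¬q = ⟨ XL ∣ XR ⟩ , X∈ , X-btw , ¬p , ¬q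

  simplicity : ∀ L R Y → Member Y → SimplestBetween L R Y → ⟨ L ∣ R ⟩ ≈g Y
  simplicity L R Y Y∈ ((L≱Y , Y≱R) , ¬left , ¬right) =
    ≤g-intro G Y L≱Y (tabulate λ y∈ y≤G → ¬right (lose y∈ (rightOpt-between y∈ y≤G))) ,
    ≤g-intro Y G (tabulate λ y∈ G≤y → ¬left (lose y∈ (leftOpt-between y∈ G≤y))) Y≱R
    where
    open ≤g-Reasoning
    G = ⟨ L ∣ R ⟩
    rightOpt-between : ∀ {y} → y ∈ rightOpts Y → y ≤g G → Between L R y
    rightOpt-between {y} y∈ y≤G =
      tabulate (λ {l} l∈ y≤l → lookup L≱Y l∈ (begin Y ≲⟨ ≤rightOpt Y Y∈ y∈ ⟩ y ≲⟨ y≤l ⟩ l ∎)) ,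
      tabulate (λ {r} r∈ r≤y → rightOpt-≱ G r∈ (begin r ≲⟨ r≤y ⟩ y ≲⟨ y≤G ⟩ G ∎))
    leftOpt-between : ∀ {y} → y ∈ leftOpts Y → G ≤g y → Between L R y
    leftOpt-between {y} y∈ G≤y =
      tabulate (λ {l} l∈ y≤l → leftOpt-≱ G l∈ (begin G ≲⟨ G≤y ⟩ y ≲⟨ y≤l ⟩ l ∎)) ,
      tabulate (λ {r} r∈ r≤y → lookup Y≱R r∈ (begin r ≲⟨ r≤y ⟩ y ≲⟨ leftOpt≤ Y Y∈ y∈ ⟩ Y ∎))

record Representation (A : Arena) : Set₁ where
  field
    Member     : Game → Set
    ordered    : IsOrderedFamily Member
    member⇒InA : ∀ G → Member G → InA A G
    num-member : ∀ x → Member (num A x)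

diamond⇒InA : ∀ {A} → Representation A → ∀ G →
              (∀ {x} → x ∈ leftOpts G → InA A x) → (∀ {x} → x ∈ rightOpts G → InA A x) →
              Diamond A G → InA A G
diamond⇒InA _ _ _ _ (inj₁ G∈A) = G∈A
diamond⇒InA {A} rep G@(⟨ L ∣ R ⟩) inL inR (inj₂ (GL , GR , x , gdL , gdR , GL≱x , x≱GR)) =
  let Y , Y∈ , simplest = simplest-between ordered L R (num A x) (num-member x) x-between
      y , Y≈y = member⇒InA Y Y∈
  in y , ≈g-trans {G} {Y} {num A y} (simplicity ordered L R Y Y∈ simplest) Y≈y
  where
  open Representation rep
  open ≤g-Reasoning
  x-between : Between L R (num A x)
  x-between =
    tabulate (λ {l} l∈ x≤l → GL≱x (begin num A x ≲⟨ x≤l ⟩ l ≲⟨ leftOpt≤guideL G inL gdL l∈ ⟩ GL ∎)) ,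
    tabulate (λ {r} r∈ r≤x → x≱GR (begin GR ≲⟨ guideR≤rightOpt G inR gdR r∈ ⟩ r ≲⟨ r≤x ⟩ num A x ∎))

-- Integers

natG≤natG-suc : ∀ n → natG n ≤g natG (suc n)
natG≤natG-suc zero = ≤g-intro (natG 0) (natG 1) [] []
natG≤natG-suc (suc n) = ≤g-intro (natG (suc n)) (natG (2 ℕ.+ n))
  ((λ le → ≤g-leftOpt (natG (2 ℕ.+ n)) (natG n) le (here refl) (natG≤natG-suc n)) ∷ []) []

-natG-suc≤-natG : ∀ n → neg (natG (suc n)) ≤g neg (natG n)
-natG-suc≤-natG zero = ≤g-intro (neg (natG 1)) (neg (natG 0)) [] []
-natG-suc≤-natG (suc n) = ≤g-intro (neg (natG (2 ℕ.+ n))) (neg (natG (suc n))) []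
  ((λ le → ≤g-rightOpt (neg (natG n)) (neg (natG (2 ℕ.+ n))) le (here refl) (-natG-suc≤-natG n)) ∷ [])

neg-natG : ∀ n → neg (natG n) ≡ intG (- + n)
neg-natG zero = refl
neg-natG (suc n) = refl

IntegerGame : Game → Set
IntegerGame G = ∃ λ z → G ≡ intG z

integerGames-ordered : IsOrderedFamily IntegerGame
integerGames-ordered = record
  { leftOpt-member  = λ { _ (+ suc n , refl) (here refl) → + n , refl }
  ; rightOpt-member = λ { _ (+ zero , refl) () ; _ (+ suc _ , refl) ()
                        ; _ (-[1+ n ] , refl) (here refl) → - + n , neg-natG n }
  ; leftOpt≤        = λ { _ (+ suc n , refl) (here refl) → natG≤natG-suc n }
  ; ≤rightOpt       = λ { _ (+ zero , refl) () ; _ (+ suc _ , refl) ()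
                        ; _ (-[1+ n ] , refl) (here refl) → -natG-suc≤-natG n }
  }

integerGames : Representation ZZ
integerGames = record
  { Member     = IntegerGame
  ; ordered    = integerGames-ordered
  ; member⇒InA = λ { _ (z , refl) → z , ≈g-refl {intG z} }
  ; num-member = λ z → z , refl
  }

-- Sums of atoms 0 and ±1/2^j

addL≡map : ∀ xs H → addL xs H ≡ map (_⊕ H) xs
addL≡map [] H = refl
addL≡map (x ∷ xs) H = cong (x ⊕ H ∷_) (addL≡map xs H)

addR≡map : ∀ G ys → addR G ys ≡ map (G ⊕_) ys
addR≡map G [] = refl
addR≡map G (y ∷ ys) = cong (G ⊕ y ∷_) (addR≡map G ys)

⊕-leftOpts : ∀ G H → leftOpts (G ⊕ H) ≡ map (_⊕ H) (leftOpts G) ++ map (G ⊕_) (leftOpts H)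
⊕-leftOpts G@(⟨ GL ∣ _ ⟩) H@(⟨ HL ∣ _ ⟩) = cong₂ _++_ (addL≡map GL H) (addR≡map G HL)

⊕-rightOpts : ∀ G H → rightOpts (G ⊕ H) ≡ map (_⊕ H) (rightOpts G) ++ map (G ⊕_) (rightOpts H)
⊕-rightOpts G@(⟨ _ ∣ GR ⟩) H@(⟨ _ ∣ HR ⟩) = cong₂ _++_ (addL≡map GR H) (addR≡map G HR)

negs-++ : ∀ xs ys → negs (xs ++ ys) ≡ negs xs ++ negs ys
negs-++ [] ys = refl
negs-++ (x ∷ xs) ys = cong (neg x ∷_) (negs-++ xs ys)

mutual
  neg-⊕ : ∀ G H → neg (G ⊕ H) ≡ neg G ⊕ neg H
  neg-⊕ G@(⟨ GL ∣ GR ⟩) H@(⟨ HL ∣ HR ⟩) = cong₂ ⟨_∣_⟩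
    (trans (negs-++ (addL GR H) _) (cong₂ _++_ (negs-addL GR H) (negs-addR G HR)))
    (trans (negs-++ (addL GL H) _) (cong₂ _++_ (negs-addL GL H) (negs-addR G HL)))

  negs-addL : ∀ xs H → negs (addL xs H) ≡ addL (negs xs) (neg H)
  negs-addL [] H = refl
  negs-addL (x ∷ xs) H = cong₂ _∷_ (neg-⊕ x H) (negs-addL xs H)

  negs-addR : ∀ G ys → negs (addR G ys) ≡ addR (neg G) (negs ys)
  negs-addR G [] = refl
  negs-addR G (y ∷ ys) = cong₂ _∷_ (neg-⊕ G y) (negs-addR G ys)

-- The Left option 0 of 1/2^j stays in a sum as a summand zeroᵃ: 0 ⊕ G is not G syntactically.
data Atom : Set where
  zeroᵃ     : Atom
  +½^_ -½^_ : ℕ → Atom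

index : Atom → ℕ
index zeroᵃ = 0
index (+½^ j) = j
index (-½^ j) = j

atomG : Atom → Game
atomG zeroᵃ = zeroG
atomG (+½^ j) = halfG j
atomG (-½^ j) = neg (halfG j)

atomSum : List Atom → Game
atomSum [] = zeroG
atomSum (a ∷ as) = atomG a ⊕ atomSum as

data LeftMoveᵃ : Atom → Atom → Set where
  drop⁺   : ∀ {j} → LeftMoveᵃ (+½^ j) zeroᵃ
  double⁻ : ∀ {j} → LeftMoveᵃ (-½^ suc j) (-½^ j)

data RightMoveᵃ : Atom → Atom → Set where
  double⁺ : ∀ {j} → RightMoveᵃ (+½^ suc j) (+½^ j)
  drop⁻   : ∀ {j} → RightMoveᵃ (-½^ j) zeroᵃ

data OneStep {A : Set} (R : A → A → Set) : List A → List A → Set where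
  here  : ∀ {a a' as} → R a a' → OneStep R (a ∷ as) (a' ∷ as)
  there : ∀ {a as bs} → OneStep R as bs → OneStep R (a ∷ as) (a ∷ bs)

OneStep-All : ∀ {A : Set} {R : A → A → Set} {P : A → Set} → (∀ {a a'} → R a a' → P a → P a') →
              ∀ {as bs} → OneStep R as bs → All P as → All P bs
OneStep-All f (here r) (pa ∷ ps) = f r pa ∷ ps
OneStep-All f (there st) (pa ∷ ps) = pa ∷ OneStep-All f st ps

LeftMove RightMove : List Atom → List Atom → Set
LeftMove = OneStep LeftMoveᵃ
RightMove = OneStep RightMoveᵃ

leftOpt-atomG⇒ : ∀ a {x} → x ∈ leftOpts (atomG a) → ∃ λ a' → LeftMoveᵃ a a' × x ≡ atomG a'
leftOpt-atomG⇒ (+½^ zero) (here x≡) = zeroᵃ , drop⁺ , x≡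
leftOpt-atomG⇒ (+½^ suc j) (here x≡) = zeroᵃ , drop⁺ , x≡
leftOpt-atomG⇒ (-½^ suc j) (here x≡) = -½^ j , double⁻ , x≡

leftOpt-atomG⇐ : ∀ {a a'} → LeftMoveᵃ a a' → atomG a' ∈ leftOpts (atomG a)
leftOpt-atomG⇐ (drop⁺ {zero}) = here refl
leftOpt-atomG⇐ (drop⁺ {suc _}) = here refl
leftOpt-atomG⇐ double⁻ = here refl

rightOpt-atomG⇒ : ∀ a {x} → x ∈ rightOpts (atomG a) → ∃ λ a' → RightMoveᵃ a a' × x ≡ atomG a'
rightOpt-atomG⇒ (+½^ suc j) (here x≡) = +½^ j , double⁺ , x≡
rightOpt-atomG⇒ (-½^ zero) (here x≡) = zeroᵃ , drop⁻ , x≡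
rightOpt-atomG⇒ (-½^ suc j) (here x≡) = zeroᵃ , drop⁻ , x≡

rightOpt-atomG⇐ : ∀ {a a'} → RightMoveᵃ a a' → atomG a' ∈ rightOpts (atomG a)
rightOpt-atomG⇐ double⁺ = here refl
rightOpt-atomG⇐ (drop⁻ {zero}) = here refl
rightOpt-atomG⇐ (drop⁻ {suc _}) = here refl

module AtomSumOptions
  (opts : Game → List Game)
  (opts-zeroG : opts zeroG ≡ [])
  (opts-⊕ : ∀ G H → opts (G ⊕ H) ≡ map (_⊕ H) (opts G) ++ map (G ⊕_) (opts H))
  (Moveᵃ : Atom → Atom → Set)
  (atom⇒ : ∀ a {x} → x ∈ opts (atomG a) → ∃ λ a' → Moveᵃ a a' × x ≡ atomG a')
  (atom⇐ : ∀ {a a'} → Moveᵃ a a' → atomG a' ∈ opts (atomG a))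
  where

  opt⇒ : ∀ as {x} → x ∈ opts (atomSum as) → ∃ λ bs → OneStep Moveᵃ as bs × x ≡ atomSum bs
  opt⇒ [] x∈ with () ← subst (_ ∈_) opts-zeroG x∈
  opt⇒ (a ∷ as) x∈
    with ∈-++⁻ (map (_⊕ atomSum as) (opts (atomG a))) (subst (_ ∈_) (opts-⊕ (atomG a) (atomSum as)) x∈)
  ... | inj₁ x∈head =
    let y , y∈ , x≡ = ∈-map⁻ (_⊕ atomSum as) x∈head
        a' , mv , y≡ = atom⇒ a y∈
    in a' ∷ as , here mv , trans x≡ (cong (_⊕ atomSum as) y≡)
  ... | inj₂ x∈tail =
    let y , y∈ , x≡ = ∈-map⁻ (atomG a ⊕_) x∈tail
        bs , st , y≡ = opt⇒ as y∈
    in a ∷ bs , there st , trans x≡ (cong (atomG a ⊕_) y≡)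

  opt⇐ : ∀ {as bs} → OneStep Moveᵃ as bs → atomSum bs ∈ opts (atomSum as)
  opt⇐ {a ∷ as} (here mv) = subst (_ ∈_) (sym (opts-⊕ (atomG a) (atomSum as)))
    (∈-++⁺ˡ (∈-map⁺ (_⊕ atomSum as) (atom⇐ mv)))
  opt⇐ {a ∷ as} (there st) = subst (_ ∈_) (sym (opts-⊕ (atomG a) (atomSum as)))
    (∈-++⁺ʳ (map (_⊕ atomSum as) (opts (atomG a))) (∈-map⁺ (atomG a ⊕_) (opt⇐ st)))

open AtomSumOptions leftOpts refl ⊕-leftOpts LeftMoveᵃ leftOpt-atomG⇒ leftOpt-atomG⇐
  renaming (opt⇒ to leftOpt-atomSum⇒; opt⇐ to leftOpt-atomSum⇐)
open AtomSumOptions rightOpts refl ⊕-rightOpts RightMoveᵃ rightOpt-atomG⇒ rightOpt-atomG⇐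
  renaming (opt⇒ to rightOpt-atomSum⇒; opt⇐ to rightOpt-atomSum⇐)

-- 2^N times the value of an atom; exact only when index a ≤ N, by truncated subtraction.
weight : ℕ → Atom → ℤ
weight N zeroᵃ = 0ℤ
weight N (+½^ j) = + 2 ^ (N ∸ j)
weight N (-½^ j) = - (+ 2 ^ (N ∸ j))

value : ℕ → List Atom → ℤ
value N [] = 0ℤ
value N (a ∷ as) = weight N a + value N as

Bounded : ℕ → List Atom → Set
Bounded N = All (λ a → index a ≤ N)

pow2-split : ∀ {j N} → suc j ≤ N → 2 ^ (N ∸ j) ≡ 2 ^ (N ∸ suc j) ℕ.+ 2 ^ (N ∸ suc j)
pow2-split {zero} {suc N} _ = cong (2 ^ N ℕ.+_) (ℕP.+-identityʳ (2 ^ N))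
pow2-split {suc j} {suc N} (s≤s j<N) = pow2-split j<N

leftMoveᵃ-weight : ∀ {N a a'} → index a ≤ N → LeftMoveᵃ a a' →
                   weight N a' ≡ weight N a - + 2 ^ (N ∸ index a)
leftMoveᵃ-weight {N} {+½^ j} _ drop⁺ = sym (ℤP.+-inverseʳ (+ 2 ^ (N ∸ j)))
leftMoveᵃ-weight {N} { -½^ suc j} j<N double⁻ = begin
  - (+ 2 ^ (N ∸ j))   ≡⟨ cong (-_ ∘ +_) (pow2-split j<N) ⟩
  - (+ (p ℕ.+ p))     ≡⟨ cong -_ (ℤP.pos-+ p p) ⟩
  - (+ p + + p)       ≡⟨ ℤP.neg-distrib-+ (+ p) (+ p) ⟩
  - (+ p) - + p       ∎
  where
  open ≡-Reasoning
  p = 2 ^ (N ∸ suc j)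

rightMoveᵃ-weight : ∀ {N a a'} → index a ≤ N → RightMoveᵃ a a' →
                    weight N a' ≡ weight N a + + 2 ^ (N ∸ index a)
rightMoveᵃ-weight {N} {+½^ suc j} j<N double⁺ =
  trans (cong +_ (pow2-split j<N)) (ℤP.pos-+ (2 ^ (N ∸ suc j)) (2 ^ (N ∸ suc j)))
rightMoveᵃ-weight {N} { -½^ j} _ drop⁻ = sym (ℤP.+-inverseˡ (+ 2 ^ (N ∸ j)))

leftMoveᵃ-index : ∀ {a a'} → LeftMoveᵃ a a' → index a' ≤ index a
leftMoveᵃ-index drop⁺ = z≤n
leftMoveᵃ-index double⁻ = ℕP.n≤1+n _

rightMoveᵃ-index : ∀ {a a'} → RightMoveᵃ a a' → index a' ≤ index a
rightMoveᵃ-index double⁺ = ℕP.n≤1+n _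
rightMoveᵃ-index drop⁻ = z≤n

leftMove-bounded : ∀ {N as bs} → LeftMove as bs → Bounded N as → Bounded N bs
leftMove-bounded = OneStep-All (ℕP.≤-trans ∘ leftMoveᵃ-index)

rightMove-bounded : ∀ {N as bs} → RightMove as bs → Bounded N as → Bounded N bs
rightMove-bounded = OneStep-All (ℕP.≤-trans ∘ rightMoveᵃ-index)

x-2^k<x : ∀ x k → x - + 2 ^ k ℤ.< x
x-2^k<x x k = subst (x - + 2 ^ k ℤ.<_) (ℤP.+-identityʳ x)
  (ℤP.+-monoʳ-< x (ℤP.neg-mono-< (ℤ.+<+ (ℕP.m^n>0 2 k))))

x<x+2^k : ∀ x k → x ℤ.< x + + 2 ^ k
x<x+2^k x k = subst (ℤ._< x + + 2 ^ k) (ℤP.+-identityʳ x) (ℤP.+-monoʳ-< x (ℤ.+<+ (ℕP.m^n>0 2 k)))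

leftMove-< : ∀ {N as bs} → Bounded N as → LeftMove as bs → value N bs ℤ.< value N as
leftMove-< {N} (a≤N ∷ _) (here {a} {as = as} mv) = ℤP.+-monoˡ-< (value N as)
  (subst (ℤ._< weight N a) (sym (leftMoveᵃ-weight a≤N mv)) (x-2^k<x (weight N a) (N ∸ index a)))
leftMove-< {N} (_ ∷ bnd) (there {a} st) = ℤP.+-monoʳ-< (weight N a) (leftMove-< bnd st)

rightMove-< : ∀ {N as bs} → Bounded N as → RightMove as bs → value N as ℤ.< value N bs
rightMove-< {N} (a≤N ∷ _) (here {a} {as = as} mv) = ℤP.+-monoˡ-< (value N as)
  (subst (weight N a ℤ.<_) (sym (rightMoveᵃ-weight a≤N mv)) (x<x+2^k (weight N a) (N ∸ index a)))
rightMove-< {N} (_ ∷ bnd) (there {a} st) = ℤP.+-monoʳ-< (weight N a) (rightMove-< bnd st)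

OneStep-at : ∀ {R : Atom → Atom → Set} {N a a' d} → weight N a' ≡ weight N a + d →
             ∀ {as} → a ∈ as → R a a' → ∃ λ bs → OneStep R as bs × value N bs ≡ value N as + d
OneStep-at {N = N} {a} {a'} {d} w≡ {_ ∷ as} (here refl) r = a' ∷ as , here r , (begin
  weight N a' + value N as      ≡⟨ cong (_+ value N as) w≡ ⟩
  weight N a + d + value N as   ≡⟨ xy∙z≈xz∙y (weight N a) d (value N as) ⟩
  weight N a + value N as + d   ∎)
  where open ≡-Reasoning
OneStep-at {N = N} w≡ {b ∷ as} (there a∈) r =
  let bs , st , v≡ = OneStep-at w≡ a∈ r in
  b ∷ bs , there st ,
  trans (cong (λ v → weight N b + v) v≡) (sym (ℤP.+-assoc (weight N b) (value N as) _))

∸-split : ∀ {j M N} → j ≤ M → M ≤ N → N ∸ j ≡ (N ∸ M) ℕ.+ (M ∸ j)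
∸-split {j} {M} {N} j≤M M≤N =
  trans (cong (_∸ j) (sym (ℕP.m∸n+n≡m M≤N))) (ℕP.+-∸-assoc (N ∸ M) j≤M)

pow2-scale : ∀ {j M N} → j ≤ M → M ≤ N → + 2 ^ (N ∸ j) ≡ + 2 ^ (N ∸ M) * + 2 ^ (M ∸ j)
pow2-scale {j} {M} {N} j≤M M≤N = trans
  (cong +_ (trans (cong (2 ^_) (∸-split j≤M M≤N)) (ℕP.^-distribˡ-+-* 2 (N ∸ M) (M ∸ j))))
  (ℤP.pos-* (2 ^ (N ∸ M)) (2 ^ (M ∸ j)))

weight-scale : ∀ {M N} a → index a ≤ M → M ≤ N → weight N a ≡ + 2 ^ (N ∸ M) * weight M a
weight-scale {M} {N} zeroᵃ _ _ = sym (ℤP.*-zeroʳ (+ 2 ^ (N ∸ M)))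
weight-scale (+½^ j) j≤M M≤N = pow2-scale j≤M M≤N
weight-scale {M} {N} (-½^ j) j≤M M≤N =
  trans (cong -_ (pow2-scale j≤M M≤N)) (ℤP.neg-distribʳ-* (+ 2 ^ (N ∸ M)) (+ 2 ^ (M ∸ j)))

value-scale : ∀ {M N as} → M ≤ N → Bounded M as → value N as ≡ + 2 ^ (N ∸ M) * value M as
value-scale {M} {N} _ [] = sym (ℤP.*-zeroʳ (+ 2 ^ (N ∸ M)))
value-scale {M} {N} {a ∷ as} M≤N (a≤M ∷ bnd) =
  trans (cong₂ _+_ (weight-scale a a≤M M≤N) (value-scale M≤N bnd))
        (sym (ℤP.*-distribˡ-+ (+ 2 ^ (N ∸ M)) (weight M a) (value M as)))

-- At scale N, values of sums of atoms of index ≤ M are multiples of 2^(N∸M).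
value-granular : ∀ {M N as bs} → M ≤ N → Bounded M as → Bounded M bs →
                 value N bs ℤ.< value N as → value N bs + + 2 ^ (N ∸ M) ℤ.≤ value N as
value-granular {M} {N} {as} {bs} M≤N bnd-as bnd-bs lt = begin
  value N bs + c   ≡⟨ cong (_+ c) (value-scale M≤N bnd-bs) ⟩
  c * q + c        ≡⟨ distrib c q ⟩
  c * (1ℤ + q)     ≤⟨ ℤP.*-monoˡ-≤-nonNeg c (ℤP.i<j⇒suc[i]≤j q<p) ⟩
  c * p            ≡⟨ value-scale M≤N bnd-as ⟨
  value N as       ∎
  where
  open ℤP.≤-Reasoning
  c = + 2 ^ (N ∸ M)
  p = value M as
  q = value M bs
  q<p : q ℤ.< p
  q<p = ℤP.*-cancelˡ-<-nonNeg c (subst₂ ℤ._<_ (value-scale M≤N bnd-bs) (value-scale M≤N bnd-as) lt)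
  distrib : ∀ c q → c * q + c ≡ c * (1ℤ + q)
  distrib = solve-∀

i+k≤j⇒i≤j-k : ∀ {i j} k → i + k ℤ.≤ j → i ℤ.≤ j - k
i+k≤j⇒i≤j-k {i} {j} k le = subst (ℤ._≤ j - k) (cancel i k) (ℤP.+-monoˡ-≤ (- k) le)
  where
  cancel : ∀ i k → i + k - k ≡ i
  cancel = solve-∀

+½^0∈⊎value≤0 : ∀ {N as} → Bounded 0 as → +½^ 0 ∈ as ⊎ value N as ℤ.≤ 0ℤ
+½^0∈⊎value≤0 [] = inj₂ ℤP.≤-refl
+½^0∈⊎value≤0 {N} {zeroᵃ ∷ as} (_ ∷ bnd) =
  Sum.map there (subst (ℤ._≤ 0ℤ) (sym (ℤP.+-identityˡ (value N as)))) (+½^0∈⊎value≤0 bnd)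
+½^0∈⊎value≤0 {as = +½^ zero ∷ _} _ = inj₁ (here refl)
+½^0∈⊎value≤0 {N} {as = -½^ j ∷ _} (_ ∷ bnd) =
  Sum.map there (ℤP.+-mono-≤ (ℤP.neg-≤-pos {2 ^ (N ∸ j)})) (+½^0∈⊎value≤0 bnd)

-½^0∈⊎0≤value : ∀ {N as} → Bounded 0 as → -½^ 0 ∈ as ⊎ 0ℤ ℤ.≤ value N as
-½^0∈⊎0≤value [] = inj₂ ℤP.≤-refl
-½^0∈⊎0≤value {N} {zeroᵃ ∷ as} (_ ∷ bnd) =
  Sum.map there (subst (0ℤ ℤ.≤_) (sym (ℤP.+-identityˡ (value N as)))) (-½^0∈⊎0≤value bnd)
-½^0∈⊎0≤value {as = +½^ _ ∷ _} (_ ∷ bnd) =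
  Sum.map there (ℤP.+-mono-≤ (ℤ.+≤+ z≤n)) (-½^0∈⊎0≤value bnd)
-½^0∈⊎0≤value {as = -½^ zero ∷ _} _ = inj₁ (here refl)

-- The value-level form of Conway's atomSum as ≰ atomSum bs: a Left option of atomSum as
-- lies above atomSum bs, or a Right option of atomSum bs lies below atomSum as.
Refutation : ℕ → List Atom → List Atom → Set
Refutation N as bs =
  (∃ λ as' → LeftMove as as' × value N bs ℤ.≤ value N as') ⊎
  (∃ λ bs' → RightMove bs bs' × value N bs' ℤ.≤ value N as)

leftMove-refutes : ∀ {N a a' as bs} → index a ≤ N → Bounded (index a) as → Bounded (index a) bs →
                   a ∈ as → LeftMoveᵃ a a' → value N bs ℤ.< value N as → Refutation N as bs
leftMove-refutes {N} {a} {bs = bs} a≤N bnd-as bnd-bs a∈ mv lt =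
  let as' , st , v≡ = OneStep-at (leftMoveᵃ-weight a≤N mv) a∈ mv in
  inj₁ (as' , st , subst (value N bs ℤ.≤_) (sym v≡)
    (i+k≤j⇒i≤j-k (+ 2 ^ (N ∸ index a)) (value-granular a≤N bnd-as bnd-bs lt)))

rightMove-refutes : ∀ {N b b' as bs} → index b ≤ N → Bounded (index b) as → Bounded (index b) bs →
                    b ∈ bs → RightMoveᵃ b b' → value N bs ℤ.< value N as → Refutation N as bs
rightMove-refutes {N} {as = as} b≤N bnd-as bnd-bs b∈ mv lt =
  let bs' , st , v≡ = OneStep-at (rightMoveᵃ-weight b≤N mv) b∈ mv in
  inj₂ (bs' , st , subst (ℤ._≤ value N as) (sym v≡) (value-granular b≤N bnd-as bnd-bs lt))

integral-refutation : ∀ {N as bs} → Bounded 0 as → Bounded 0 bs →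
                      value N bs ℤ.< value N as → Refutation N as bs
integral-refutation {N} bnd-as bnd-bs lt
  with +½^0∈⊎value≤0 {N} bnd-as | -½^0∈⊎0≤value {N} bnd-bs
... | inj₁ +1∈ | _ = leftMove-refutes z≤n bnd-as bnd-bs +1∈ drop⁺ lt
... | inj₂ _ | inj₁ -1∈ = rightMove-refutes z≤n bnd-as bnd-bs -1∈ drop⁻ lt
... | inj₂ as≤0 | inj₂ 0≤bs = ⊥-elim (ℤP.<⇒≱ lt (ℤP.≤-trans as≤0 0≤bs))

leftMoveᵃ⊎index≡0 : ∀ a → (∃ λ a' → LeftMoveᵃ a a') ⊎ index a ≡ 0
leftMoveᵃ⊎index≡0 zeroᵃ = inj₂ refl
leftMoveᵃ⊎index≡0 (+½^ _) = inj₁ (zeroᵃ , drop⁺)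
leftMoveᵃ⊎index≡0 (-½^ zero) = inj₂ refl
leftMoveᵃ⊎index≡0 (-½^ suc j) = inj₁ (-½^ j , double⁻)

rightMoveᵃ⊎index≡0 : ∀ a → (∃ λ a' → RightMoveᵃ a a') ⊎ index a ≡ 0
rightMoveᵃ⊎index≡0 zeroᵃ = inj₂ refl
rightMoveᵃ⊎index≡0 (+½^ zero) = inj₂ refl
rightMoveᵃ⊎index≡0 (+½^ suc j) = inj₁ (+½^ j , double⁺)
rightMoveᵃ⊎index≡0 (-½^ _) = inj₁ (zeroᵃ , drop⁻)

top : List Atom → Atom
top = argmax index zeroᵃ

bounded-top : ∀ as → Bounded (index (top as)) as
bounded-top = f[xs]≤f[argmax] zeroᵃ

-- Moving an atom of the largest index M changes the value by exactly the granularity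
-- 2^(N∸M).  Only if M = 0 may no atom of index M be movable, and then signs decide.
value<⇒refutation : ∀ {N as bs} → Bounded N as → Bounded N bs →
                    value N bs ℤ.< value N as → Refutation N as bs
value<⇒refutation {N} {as} {bs} bnd-as bnd-bs lt = by-top (argmax-sel index zeroᵃ (as ++ bs))
  where
  t = top (as ++ bs)
  t≤N : index t ≤ N
  t≤N = argmax-all index {P = λ a → index a ≤ N} z≤n (++⁺ bnd-as bnd-bs)
  as≤t : Bounded (index t) as
  as≤t = proj₁ (++⁻ as (bounded-top (as ++ bs)))
  bs≤t : Bounded (index t) bs
  bs≤t = proj₂ (++⁻ as (bounded-top (as ++ bs)))
  integral : index t ≡ 0 → Refutation N as bs
  integral t≡0 =
    integral-refutation (subst (λ M → Bounded M as) t≡0 as≤t) (subst (λ M → Bounded M bs) t≡0 bs≤t) lt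
  by-top : t ≡ zeroᵃ ⊎ t ∈ as ++ bs → Refutation N as bs
  by-top (inj₁ t≡0) = integral (cong index t≡0)
  by-top (inj₂ t∈) with ∈-++⁻ as t∈
  ... | inj₁ t∈as = Sum.[ (λ (_ , mv) → leftMove-refutes t≤N as≤t bs≤t t∈as mv lt) , integral ]′
                        (leftMoveᵃ⊎index≡0 t)
  ... | inj₂ t∈bs = Sum.[ (λ (_ , mv) → rightMove-refutes t≤N as≤t bs≤t t∈bs mv lt) , integral ]′
                        (rightMoveᵃ⊎index≡0 t)

mutual
  atomSum-≤-bounded : ∀ n {N as bs} → size (atomSum as) ℕ.+ size (atomSum bs) < n →
                      Bounded N as → Bounded N bs → value N as ℤ.≤ value N bs → atomSum as ≤g atomSum bs
  atomSum-≤-bounded (suc n) {N} {as} {bs} sz bnd-as bnd-bs as≤bs =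
    ≤g-intro (atomSum as) (atomSum bs) (tabulate left) (tabulate right)
    where
    left : ∀ {x} → x ∈ leftOpts (atomSum as) → x ≱g atomSum bs
    left x∈ with leftOpt-atomSum⇒ as x∈
    ... | as' , st , refl = atomSum-≰-bounded n (shrink-first (size-leftOpt (atomSum as) x∈) sz)
      bnd-bs (leftMove-bounded st bnd-as) (ℤP.<-≤-trans (leftMove-< bnd-as st) as≤bs)
    right : ∀ {y} → y ∈ rightOpts (atomSum bs) → atomSum as ≱g y
    right y∈ with rightOpt-atomSum⇒ bs y∈
    ... | bs' , st , refl = atomSum-≰-bounded n (shrink-second (size-rightOpt (atomSum bs) y∈) sz)
      (rightMove-bounded st bnd-bs) bnd-as (ℤP.≤-<-trans as≤bs (rightMove-< bnd-bs st))

  atomSum-≰-bounded : ∀ n {N as bs} → size (atomSum as) ℕ.+ size (atomSum bs) < n →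
                      Bounded N as → Bounded N bs → value N bs ℤ.< value N as → atomSum bs ≱g atomSum as
  atomSum-≰-bounded (suc n) {N} {as} {bs} sz bnd-as bnd-bs bs<as as≤bs
    with value<⇒refutation bnd-as bnd-bs bs<as
  ... | inj₁ (as' , st , bs≤as') =
    let as'∈ = leftOpt-atomSum⇐ st in
    ≤g-leftOpt (atomSum as) (atomSum bs) as≤bs as'∈ (atomSum-≤-bounded n
      (shrink-first (size-leftOpt (atomSum as) as'∈) sz) bnd-bs (leftMove-bounded st bnd-as) bs≤as')
  ... | inj₂ (bs' , st , bs'≤as) =
    let bs'∈ = rightOpt-atomSum⇐ st in
    ≤g-rightOpt (atomSum as) (atomSum bs) as≤bs bs'∈ (atomSum-≤-bounded n
      (shrink-second (size-rightOpt (atomSum bs) bs'∈) sz) (rightMove-bounded st bnd-bs) bnd-as bs'≤as)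

atomSum-mono : ∀ {N as bs} → Bounded N as → Bounded N bs →
               value N as ℤ.≤ value N bs → atomSum as ≤g atomSum bs
atomSum-mono = atomSum-≤-bounded _ ℕP.≤-refl

atomSum-cong : ∀ {N as bs} → Bounded N as → Bounded N bs →
               value N as ≡ value N bs → atomSum as ≈g atomSum bs
atomSum-cong bnd-as bnd-bs v≡ =
  atomSum-mono bnd-as bnd-bs (ℤP.≤-reflexive v≡) , atomSum-mono bnd-bs bnd-as (ℤP.≤-reflexive (sym v≡))

-- Dyadic rationals

dyadicAtoms : ℤ × ℕ → List Atom
dyadicAtoms (+ n , k) = replicate n (+½^ k)
dyadicAtoms (-[1+ n ] , k) = replicate (suc n) (-½^ k)

mulℕ-halfG≡atomSum : ∀ n k → mulℕ n (halfG k) ≡ atomSum (replicate n (+½^ k))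
mulℕ-halfG≡atomSum zero k = refl
mulℕ-halfG≡atomSum (suc n) k = cong (halfG k ⊕_) (mulℕ-halfG≡atomSum n k)

neg-mulℕ-halfG≡atomSum : ∀ n k → neg (mulℕ n (halfG k)) ≡ atomSum (replicate n (-½^ k))
neg-mulℕ-halfG≡atomSum zero k = refl
neg-mulℕ-halfG≡atomSum (suc n) k =
  trans (neg-⊕ (halfG k) (mulℕ n (halfG k))) (cong (neg (halfG k) ⊕_) (neg-mulℕ-halfG≡atomSum n k))

dyG≡atomSum : ∀ x → dyG x ≡ atomSum (dyadicAtoms x)
dyG≡atomSum (+ n , k) = mulℕ-halfG≡atomSum n k
dyG≡atomSum (-[1+ n ] , k) = neg-mulℕ-halfG≡atomSum (suc n) k

bounded-dyadicAtoms : ∀ m k → Bounded k (dyadicAtoms (m , k))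
bounded-dyadicAtoms (+ n) k = replicate⁺ n ℕP.≤-refl
bounded-dyadicAtoms -[1+ n ] k = replicate⁺ (suc n) ℕP.≤-refl

weight-+½^ : ∀ k → weight k (+½^ k) ≡ 1ℤ
weight-+½^ k = cong (λ e → + 2 ^ e) (ℕP.n∸n≡0 k)

value-dyadicAtoms : ∀ m k → value k (dyadicAtoms (m , k)) ≡ m
value-dyadicAtoms (+ n) k = positive n
  where
  positive : ∀ n → value k (replicate n (+½^ k)) ≡ + n
  positive zero = refl
  positive (suc n) = cong₂ _+_ (weight-+½^ k) (positive n)
value-dyadicAtoms -[1+ n ] k = negative (suc n)
  where
  negative : ∀ n → value k (replicate n (-½^ k)) ≡ - (+ n)
  negative zero = refl
  negative (suc n) = trans (cong₂ _+_ (cong -_ (weight-+½^ k)) (negative n))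
                           (sym (ℤP.neg-distrib-+ 1ℤ (+ n)))

AtomSum : Game → Set
AtomSum G = ∃ λ as → G ≡ atomSum as

atomSums-ordered : IsOrderedFamily AtomSum
atomSums-ordered = record
  { leftOpt-member  = λ { _ (as , refl) x∈ → let bs , _ , x≡ = leftOpt-atomSum⇒ as x∈ in bs , x≡ }
  ; rightOpt-member = λ { _ (as , refl) x∈ → let bs , _ , x≡ = rightOpt-atomSum⇒ as x∈ in bs , x≡ }
  ; leftOpt≤        = leftOpt≤
  ; ≤rightOpt       = ≤rightOpt
  }
  where
  leftOpt≤ : ∀ G {x} → AtomSum G → x ∈ leftOpts G → x ≤g G
  leftOpt≤ _ (as , refl) x∈ with leftOpt-atomSum⇒ as x∈
  ... | bs , st , refl = atomSum-mono (leftMove-bounded st (bounded-top as)) (bounded-top as)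
                           (ℤP.<⇒≤ (leftMove-< (bounded-top as) st))
  ≤rightOpt : ∀ G {x} → AtomSum G → x ∈ rightOpts G → G ≤g x
  ≤rightOpt _ (as , refl) x∈ with rightOpt-atomSum⇒ as x∈
  ... | bs , st , refl = atomSum-mono (bounded-top as) (rightMove-bounded st (bounded-top as))
                           (ℤP.<⇒≤ (rightMove-< (bounded-top as) st))

atomSum-InA : ∀ as → InA DD (atomSum as)
atomSum-InA as = x , subst (atomSum as ≈g_) (sym (dyG≡atomSum x))
  (atomSum-cong (bounded-top as) (bounded-dyadicAtoms (value M as) M)
                (sym (value-dyadicAtoms (value M as) M)))
  where
  M = index (top as)
  x = value M as , M

atomSums : Representation DD
atomSums = record
  { Member     = AtomSum
  ; ordered    = atomSums-ordered
  ; member⇒InA = λ { _ (as , refl) → atomSum-InA as }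
  ; num-member = λ x → dyadicAtoms x , dyG≡atomSum x
  }

representation : ∀ A → Representation A
representation ZZ = integerGames
representation DD = atomSums

corollary1 : (A : Arena) (𝒢 : Game → Set) →
    ClosedUnderOptions 𝒢 →
    (∀ G → 𝒢 G → Diamond A G) →
    ∀ G → 𝒢 G → InA A G
corollary1 A 𝒢 closed diamond = game-ind (λ G → 𝒢 G → InA A G) step
  where
  step : ∀ {L R} → All (λ G → 𝒢 G → InA A G) L → All (λ G → 𝒢 G → InA A G) R →
         𝒢 ⟨ L ∣ R ⟩ → InA A ⟨ L ∣ R ⟩
  step ihL ihR G∈𝒢 = diamond⇒InA (representation A) _
    (λ x∈ → lookup ihL x∈ (proj₁ (closed _ G∈𝒢) _ x∈))
    (λ x∈ → lookup ihR x∈ (proj₂ (closed _ G∈𝒢) _ x∈))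
    (diamond _ G∈𝒢)
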